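{- Let $n, r$ be positive integers and let $G$ be the vertex-disjoint union of paths $P_1,\dots,P_n$, where $P_i$ has vertex set $\{x_i,y_i,z_i\}$ and edge set $\{x_iy_i, y_iz_i\}$. Let $L = \{x_1,\dots,x_n,z_1,\dots,z_n\}$. Let $\mathcal{F} \subseteq \mathcal{I}^{(r)}_G$ be an intersecting family. Then $|\Phi(\mathcal{F})| = |\mathcal{F}|$, and $A \cap B \cap L \neq \emptyset$ for all $A, B \in \Phi(\mathcal{F})$.
   Context: $\mathcal{I}^{(r)}_G$ denotes the family of independent sets of $G$ of size exactly $r$. A family is intersecting if any two of its members intersect. For $i \in [n]$, let $\phi_i : V(G) \to V(G)$ be given by $\phi_i(y_i) = x_i$ and $\phi_i(v) = v$ for all other vertices $v$; for $A \subseteq V(G)$ set $\phi_i(A) = \{\phi_i(a) : a \in A\}$ (if $A$ is independent then so is $\phi_i(A)$). For $\mathcal{F} \subseteq \mathcal{I}^{(r)}_G$ define $\Phi_i(\mathcal{F}) = \{\phi_i(A) : A \in \mathcal{F}\} \cup \{A : A \in \mathcal{F} \text{ and } \phi_i(A) \in \mathcal{F}\}$, and define $\Phi(\mathcal{F}) = \Phi_1(\Phi_2(\cdots \Phi_n(\mathcal{F})\cdots))$, the composition of the operations $\Phi_1,\dots,\Phi_n$ applied to $\mathcal{F}$. -}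

module Defs where

open import Data.Nat using (ℕ; zero; suc; _*_)
open import Data.Bool using (Bool; true; false; _∧_; _∨_; T; not)
import Data.Bool.Properties as BoolP
open import Data.Fin using (Fin; combine) renaming (zero to f0; suc to fs)
open import Data.Fin.Subset using (Subset; _∈_; _∩_; ∣_∣; Nonempty; inside; outside)
open import Data.Vec using (Vec; []; _∷_; lookup; _[_]≔_)
import Data.Vec.Properties as VecP
open import Data.List using (List; []; _∷_; _++_; filter; length; foldr)
open import Data.Bool.ListAction using (any)
open import Data.List using (allFin) renaming (map to lmap)
open import Data.Product using (Σ; _×_; ∃)
open import Data.Sum using (_⊎_)
open import Relation.Nullary using (¬_)
open import Relation.Nullary.Decidable using (⌊_⌋)
open import Relation.Binary.PropositionalEquality using (_≡_)

-- The graph G on n disjoint paths x_i - y_i - z_i.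
-- Vertex set V(G) = Fin (n * 3); vertex (i , j) is  combine i j,
-- with j = 0 for x_i, j = 1 for y_i, j = 2 for z_i.
Vtx : ℕ → Set
Vtx n = Fin (n * 3)

x y z : (n : ℕ) → Fin n → Vtx n
x n i = combine {n} {3} i f0
y n i = combine {n} {3} i (fs f0)
z n i = combine {n} {3} i (fs (fs f0))

VSet : ℕ → Set
VSet n = Subset (n * 3)

Independent : ∀ {n} → VSet n → Set
Independent {n} A = (i : Fin n) → ¬ (x n i ∈ A × y n i ∈ A) × ¬ (y n i ∈ A × z n i ∈ A)

InL : (n : ℕ) → Vtx n → Set
InL n v = Σ (Fin n) λ i → v ≡ x n i ⊎ v ≡ z n i

Family : ℕ → Set
Family n = VSet n → Bool

_∈F_ : ∀ {n} → VSet n → Family n → Set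
A ∈F F = T (F A)

allSubsets : (m : ℕ) → List (Subset m)
allSubsets zero = [] ∷ []
allSubsets (suc m) = lmap (false ∷_) (allSubsets m) ++ lmap (true ∷_) (allSubsets m)

card : (n : ℕ) → Family n → ℕ
card n F = length (filter (λ A → T? (F A)) (allSubsets (n * 3)))
  where
  open import Data.Bool.Properties using (T?)

FamIndep : ∀ {n} → ℕ → Family n → Set
FamIndep {n} r F = ∀ (A : VSet n) → _∈F_ {n} A F → Independent {n} A × ∣_∣ {n * 3} A ≡ r

Intersecting : ∀ {n} → Family n → Set
Intersecting {n} F = ∀ (A B : VSet n) → _∈F_ {n} A F → _∈F_ {n} B F → Nonempty {n * 3} (A ∩ B)

phi : ∀ {n} → Fin n → VSet n → VSet n
phi {n} i A with lookup A (y n i)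
... | true  = (A [ y n i ]≔ outside) [ x n i ]≔ inside
... | false = A

_≟S_ : ∀ {m} (A B : Subset m) → Bool
A ≟S B = ⌊ VecP.≡-dec BoolP._≟_ A B ⌋

Phi : {n : ℕ} → Fin n → Family n → Family n
Phi {n} i F B =
  any (λ A → F A ∧ (phi i A ≟S B)) (allSubsets (n * 3)) ∨ (F B ∧ F (phi i B))

-- Φ(F) = Φ_1(Φ_2(⋯Φ_n(F)⋯))   (indices 0..n-1 here)
PhiAll : (n : ℕ) → Family n → Family n
PhiAll n F = foldr Phi F (allFin n)

module Submission where

-- Fix i and group the subsets of V(G) into squares {S, S+x_i, S+y_i, S+x_i+y_i} with x_i, y_i ∉ S.
-- On such a square Φ_i(F) contains S iff F does, S+x_i iff F contains S+x_i or S+y_i, S+y_i iff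
-- F contains both, and never S+x_i+y_i, which F misses by independence; so |Φ_i(F)| = |F|.
-- Since φ_i maps independent r-sets to independent r-sets, every Φ_i(F) again lies in I^(r)_G.
-- For the intersection property, induct on the set J of indices already processed: any two
-- members of the current family share a vertex outside {y_j : j ∈ J}.  Applying Φ_i, a shared y_i
-- becomes a shared x_i when both sets are φ_i-images; otherwise one of them, say A ∋ y_i, is
-- compared with the φ_i-image of the other, and the vertex they share is neither y_i nor, by
-- independence of A, x_i.  For J = [n] the shared vertex lies in L.

open import Defs
open import Algebra.Properties.CommutativeSemigroup using (interchange)
open import Data.Bool using (Bool; true; false; T; _∧_; _∨_; if_then_else_)
open import Data.Bool.Properties using (T?; T-≡; T-∧; T-∨; ⇔→≡)
open import Data.Empty using (⊥; ⊥-elim)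
open import Data.Fin using (Fin; zero; suc)
open import Data.Fin.Properties using (combine-injective; combine-surjective) renaming (_≟_ to _≟ᶠ_)
open import Data.Fin.Subset using (Subset; ∣_∣; _∈_)
open import Data.Fin.Subset.Properties using (x∈p∩q⁻)
open import Data.List using (List; []; _∷_; _++_; filter; length; foldr; allFin) renaming (map to lmap)
open import Data.List.Properties using (map-++; map-∘)
open import Data.List.Membership.Propositional using (lose) renaming (_∈_ to _∈ˡ_)
open import Data.List.Membership.Propositional.Properties using (∈-map⁺; ∈-++⁺ˡ; ∈-++⁺ʳ; ∈-allFin)
open import Data.List.Relation.Unary.Any using (satisfied; here; there)
open import Data.List.Relation.Unary.Any.Properties using (any⁺; any⁻)
open import Data.Nat using (ℕ; NonZero; zero; suc; _+_; _*_)
open import Data.Nat.ListAction using (sum)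
open import Data.Nat.ListAction.Properties using (sum-++)
open import Data.Nat.Properties using (+-identityʳ; +-suc; +-commutativeSemigroup)
open import Data.Nat.Tactic.RingSolver using (solve-∀)
open import Data.Product using (∃; _×_; _,_; proj₁; proj₂)
open import Data.Sum using (_⊎_; inj₁; inj₂)
open import Data.Vec using ([]; _∷_; lookup; _[_]≔_)
open import Data.Vec.Properties
  using (lookup∘update; lookup∘update′; []≔-idempotent; []≔-commutes; []≔-lookup; []=⇒lookup; lookup⇒[]=)
open import Function using (_∘_; mk⇔; Equivalence)
open import Relation.Nullary using (¬_; yes; no)
open import Relation.Nullary.Decidable using (toWitness; fromWitness)
open import Relation.Binary.PropositionalEquality

open Equivalence using (to; from)

indicator : Bool → ℕ
indicator true  = 1
indicator false = 0

indicator-∨-∧ : ∀ a b → indicator (a ∨ b) + indicator (a ∧ b) ≡ indicator a + indicator b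
indicator-∨-∧ true  b = refl
indicator-∨-∧ false b = +-identityʳ (indicator b)

T-ext : ∀ {a b} → (T a → T b) → (T b → T a) → a ≡ b
T-ext a⇒b b⇒a = ⇔→≡ {z = true} (mk⇔ (to T-≡ ∘ a⇒b ∘ from T-≡) (to T-≡ ∘ b⇒a ∘ from T-≡))

∑ₛ : (m : ℕ) → (Subset m → ℕ) → ℕ
∑ₛ zero    h = h []
∑ₛ (suc m) h = ∑ₛ m (h ∘ (false ∷_)) + ∑ₛ m (h ∘ (true ∷_))

∑ₛ-cong : ∀ m {h g : Subset m → ℕ} → (∀ S → h S ≡ g S) → ∑ₛ m h ≡ ∑ₛ m g
∑ₛ-cong zero    h≗g = h≗g []
∑ₛ-cong (suc m) h≗g = cong₂ _+_ (∑ₛ-cong m (h≗g ∘ (false ∷_))) (∑ₛ-cong m (h≗g ∘ (true ∷_)))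

∑ₛ-distrib-+ : ∀ m (h g : Subset m → ℕ) → ∑ₛ m (λ S → h S + g S) ≡ ∑ₛ m h + ∑ₛ m g
∑ₛ-distrib-+ zero    h g = refl
∑ₛ-distrib-+ (suc m) h g =
  trans (cong₂ _+_ (∑ₛ-distrib-+ m h₀ g₀) (∑ₛ-distrib-+ m h₁ g₁))
        (interchange +-commutativeSemigroup (∑ₛ m h₀) (∑ₛ m g₀) (∑ₛ m h₁) (∑ₛ m g₁))
  where
  h₀ = h ∘ (false ∷_)
  h₁ = h ∘ (true ∷_)
  g₀ = g ∘ (false ∷_)
  g₁ = g ∘ (true ∷_)

∑ₛ-zero : ∀ m → ∑ₛ m (λ _ → 0) ≡ 0
∑ₛ-zero zero    = refl
∑ₛ-zero (suc m) = cong₂ _+_ (∑ₛ-zero m) (∑ₛ-zero m)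

sum-allSubsets : ∀ m (h : Subset m → ℕ) → sum (lmap h (allSubsets m)) ≡ ∑ₛ m h
sum-allSubsets zero    h = +-identityʳ (h [])
sum-allSubsets (suc m) h = begin
  sum (lmap h (lmap (false ∷_) Ss ++ lmap (true ∷_) Ss))
    ≡⟨ cong sum (map-++ h (lmap (false ∷_) Ss) _) ⟩
  sum (lmap h (lmap (false ∷_) Ss) ++ lmap h (lmap (true ∷_) Ss))
    ≡⟨ sum-++ (lmap h (lmap (false ∷_) Ss)) _ ⟩
  sum (lmap h (lmap (false ∷_) Ss)) + sum (lmap h (lmap (true ∷_) Ss))
    ≡⟨ cong₂ (λ l l′ → sum l + sum l′) (map-∘ Ss) (map-∘ Ss) ⟨
  sum (lmap (h ∘ (false ∷_)) Ss) + sum (lmap (h ∘ (true ∷_)) Ss)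
    ≡⟨ cong₂ _+_ (sum-allSubsets m _) (sum-allSubsets m _) ⟩
  ∑ₛ (suc m) h ∎
  where
  open ≡-Reasoning
  Ss = allSubsets m

∈-allSubsets : ∀ {m} (S : Subset m) → S ∈ˡ allSubsets m
∈-allSubsets []          = here refl
∈-allSubsets (false ∷ S) = ∈-++⁺ˡ (∈-map⁺ (false ∷_) (∈-allSubsets S))
∈-allSubsets (true  ∷ S) = ∈-++⁺ʳ (lmap (false ∷_) (allSubsets _)) (∈-map⁺ (true ∷_) (∈-allSubsets S))

length-filter-T : ∀ {A : Set} (f : A → Bool) xs →
                  length (filter (T? ∘ f) xs) ≡ sum (lmap (indicator ∘ f) xs)
length-filter-T f []       = refl
length-filter-T f (x ∷ xs) with f x
... | true  = cong suc (length-filter-T f xs)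
... | false = length-filter-T f xs

card≡∑ₛ : ∀ n (F : Family n) → card n F ≡ ∑ₛ (n * 3) (indicator ∘ F)
card≡∑ₛ n F = trans (length-filter-T F (allSubsets (n * 3))) (sum-allSubsets (n * 3) _)

pairUp : ∀ {m} → Fin m → (Subset m → ℕ) → Subset m → ℕ
pairUp p h S = if lookup S p then 0 else h S + h (S [ p ]≔ true)

∑ₛ-pairUp : ∀ m (p : Fin m) h → ∑ₛ m (pairUp p h) ≡ ∑ₛ m h
∑ₛ-pairUp (suc m) zero    h =
  trans (cong₂ _+_ (∑ₛ-distrib-+ m _ _) (∑ₛ-zero m)) (+-identityʳ _)
∑ₛ-pairUp (suc m) (suc p) h =
  cong₂ _+_ (∑ₛ-pairUp m p (h ∘ (false ∷_))) (∑ₛ-pairUp m p (h ∘ (true ∷_)))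

squareSum : ∀ {m} → Fin m → Fin m → (Subset m → ℕ) → Subset m → ℕ
squareSum p q h S = (h S + h ((S [ q ]≔ true) [ p ]≔ true)) + (h (S [ p ]≔ true) + h (S [ q ]≔ true))

-- Each subset lies in exactly one square {S, S ∪ {p}, S ∪ {q}, S ∪ {p, q}} with p, q ∉ S.
∑ₛ-cong-squares : ∀ m {p q : Fin m} {h g : Subset m → ℕ} → p ≢ q →
                  (∀ S → lookup S p ≡ false → lookup S q ≡ false →
                         squareSum p q h S ≡ squareSum p q g S) →
                  ∑ₛ m h ≡ ∑ₛ m g
∑ₛ-cong-squares m {p} {q} {h} {g} p≢q squares≡ = begin
  ∑ₛ m h                         ≡⟨ ∑ₛ-pairUp m p h ⟨
  ∑ₛ m (pairUp p h)              ≡⟨ ∑ₛ-pairUp m q (pairUp p h) ⟨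
  ∑ₛ m (pairUp q (pairUp p h))   ≡⟨ ∑ₛ-cong m pairs≡ ⟩
  ∑ₛ m (pairUp q (pairUp p g))   ≡⟨ ∑ₛ-pairUp m q (pairUp p g) ⟩
  ∑ₛ m (pairUp p g)              ≡⟨ ∑ₛ-pairUp m p g ⟩
  ∑ₛ m g                         ∎
  where
  open ≡-Reasoning
  regroup : ∀ a b c d → a + b + (c + d) ≡ a + d + (b + c)
  regroup = solve-∀
  pairs≡ : ∀ S → pairUp q (pairUp p h) S ≡ pairUp q (pairUp p g) S
  pairs≡ S with lookup S q in q∉S
  ... | true  = refl
  ... | false rewrite lookup∘update′ p≢q S true with lookup S p in p∉S
  ...   | true  = refl
  ...   | false = begin
    h S + h Sp + (h Sq + h Sqp)   ≡⟨ regroup (h S) (h Sp) (h Sq) (h Sqp) ⟩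
    squareSum p q h S             ≡⟨ squares≡ S p∉S q∉S ⟩
    squareSum p q g S             ≡⟨ regroup (g S) (g Sp) (g Sq) (g Sqp) ⟨
    g S + g Sp + (g Sq + g Sqp)   ∎
    where
    Sp  = S [ p ]≔ true
    Sq  = S [ q ]≔ true
    Sqp = Sq [ p ]≔ true

[]≔-lookup′ : ∀ {m} (S : Subset m) {p b} → lookup S p ≡ b → S [ p ]≔ b ≡ S
[]≔-lookup′ S {p} refl = []≔-lookup S p

∣[]≔∣ : ∀ {m} (S : Subset m) p b → ∣ S [ p ]≔ b ∣ + indicator (lookup S p) ≡ ∣ S ∣ + indicator b
∣[]≔∣ (true  ∷ S) zero true  = refl
∣[]≔∣ (false ∷ S) zero false = refl
∣[]≔∣ (true  ∷ S) zero false = +-suc ∣ S ∣ 0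
∣[]≔∣ (false ∷ S) zero true  = sym (+-suc ∣ S ∣ 0)
∣[]≔∣ (true  ∷ S) (suc p) b  = cong suc (∣[]≔∣ S p b)
∣[]≔∣ (false ∷ S) (suc p) b  = ∣[]≔∣ S p b

module _ {m} (S : Subset m) {p q : Fin m} (p≢q : p ≢ q)
         (p∈S : lookup S p ≡ true) (q∉S : lookup S q ≡ false) where

  private
    S′ = (S [ p ]≔ false) [ q ]≔ true

  ∣move∣ : ∣ S′ ∣ ≡ ∣ S ∣
  ∣move∣ = begin
    ∣ S′ ∣                                            ≡⟨ +-identityʳ _ ⟨
    ∣ S′ ∣ + 0                                        ≡⟨ cong (λ b → ∣ S′ ∣ + indicator b) q∉S′ ⟨
    ∣ S′ ∣ + indicator (lookup (S [ p ]≔ false) q)   ≡⟨ ∣[]≔∣ (S [ p ]≔ false) q true ⟩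
    ∣ S [ p ]≔ false ∣ + 1                            ≡⟨ cong (λ b → ∣ S [ p ]≔ false ∣ + indicator b) p∈S ⟨
    ∣ S [ p ]≔ false ∣ + indicator (lookup S p)      ≡⟨ ∣[]≔∣ S p false ⟩
    ∣ S ∣ + 0                                         ≡⟨ +-identityʳ _ ⟩
    ∣ S ∣                                             ∎
    where
    open ≡-Reasoning
    q∉S′ : lookup (S [ p ]≔ false) q ≡ false
    q∉S′ = trans (lookup∘update′ (p≢q ∘ sym) S false) q∉S

  move-back : (S′ [ q ]≔ false) [ p ]≔ true ≡ S
  move-back = begin
    (S′ [ q ]≔ false) [ p ]≔ true                   ≡⟨ cong (_[ p ]≔ true) ([]≔-idempotent (S [ p ]≔ false) q) ⟩
    ((S [ p ]≔ false) [ q ]≔ false) [ p ]≔ true    ≡⟨ cong (_[ p ]≔ true) ([]≔-commutes S p q p≢q) ⟩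
    ((S [ q ]≔ false) [ p ]≔ false) [ p ]≔ true    ≡⟨ []≔-idempotent (S [ q ]≔ false) p ⟩
    (S [ q ]≔ false) [ p ]≔ true                    ≡⟨ cong (_[ p ]≔ true) ([]≔-lookup′ S q∉S) ⟩
    S [ p ]≔ true                                    ≡⟨ []≔-lookup′ S p∈S ⟩
    S                                                ∎
    where open ≡-Reasoning

module _ (n : ℕ) where

  x≢y : ∀ i j → x n i ≢ y n j
  x≢y i j eq with () ← proj₂ (combine-injective i zero j (suc zero) eq)

  z≢x : ∀ i j → z n i ≢ x n j
  z≢x i j eq with () ← proj₂ (combine-injective i (suc (suc zero)) j zero eq)

  z≢y : ∀ i j → z n i ≢ y n j
  z≢y i j eq with () ← proj₂ (combine-injective i (suc (suc zero)) j (suc zero) eq)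

  x-injective : ∀ {i j} → x n i ≡ x n j → i ≡ j
  x-injective {i} {j} eq = proj₁ (combine-injective i zero j zero eq)

  y-injective : ∀ {i j} → y n i ≡ y n j → i ≡ j
  y-injective {i} {j} eq = proj₁ (combine-injective i (suc zero) j (suc zero) eq)

  module _ (i : Fin n) where

    phi-on-y : ∀ A → lookup A (y n i) ≡ true → phi i A ≡ (A [ y n i ]≔ false) [ x n i ]≔ true
    phi-on-y A y∈A with lookup A (y n i)
    ... | true = refl

    phi-off-y : ∀ A → lookup A (y n i) ≡ false → phi i A ≡ A
    phi-off-y A y∉A with lookup A (y n i)
    ... | false = refl

    x∉phi⇒phi≡ : ∀ A → lookup (phi i A) (x n i) ≡ false → phi i A ≡ A
    x∉phi⇒phi≡ A x∉phiA with lookup A (y n i)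
    ... | true  with () ← trans (sym (lookup∘update (x n i) (A [ y n i ]≔ false) true)) x∉phiA
    ... | false = refl

    y∉phi : ∀ A → lookup (phi i A) (y n i) ≡ false
    y∉phi A with lookup A (y n i) in y∉A
    ... | true  = trans (lookup∘update′ (x≢y i i ∘ sym) (A [ y n i ]≔ false) true)
                        (lookup∘update (y n i) A false)
    ... | false = y∉A

    x∈phi : ∀ A → lookup A (y n i) ≡ true → lookup (phi i A) (x n i) ≡ true
    x∈phi A y∈A rewrite phi-on-y A y∈A = lookup∘update (x n i) (A [ y n i ]≔ false) true

    lookup-phi : ∀ A {v} → v ≢ x n i → v ≢ y n i → lookup (phi i A) v ≡ lookup A v
    lookup-phi A v≢x v≢y with lookup A (y n i)
    ... | true  = trans (lookup∘update′ v≢x (A [ y n i ]≔ false) true) (lookup∘update′ v≢y A false)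
    ... | false = refl

    phi-preserves-∈ : ∀ A {v} → v ≢ y n i → lookup A v ≡ true → lookup (phi i A) v ≡ true
    phi-preserves-∈ A {v} v≢y v∈A with v ≟ᶠ x n i
    ... | no v≢x = trans (lookup-phi A v≢x v≢y) v∈A
    ... | yes refl with lookup A (y n i)
    ...   | true  = lookup∘update (x n i) (A [ y n i ]≔ false) true
    ...   | false = v∈A

    x∉-independent : ∀ {A} → Independent {n} A → lookup A (y n i) ≡ true → lookup A (x n i) ≡ false
    x∉-independent {A} indA y∈A with lookup A (x n i) in x∈A
    ... | false = refl
    ... | true  = ⊥-elim (proj₁ (indA i) (lookup⇒[]= (x n i) A x∈A , lookup⇒[]= (y n i) A y∈A))

    phi-injective : ∀ {A B} → lookup A (x n i) ≡ false → lookup A (y n i) ≡ true →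
                    lookup B (x n i) ≡ false → lookup B (y n i) ≡ true → phi i A ≡ phi i B → A ≡ B
    phi-injective {A} {B} x∉A y∈A x∉B y∈B eq = begin
      A                                                          ≡⟨ move-back A (x≢y i i ∘ sym) y∈A x∉A ⟨
      (((A [ y n i ]≔ false) [ x n i ]≔ true) [ x n i ]≔ false) [ y n i ]≔ true
        ≡⟨ cong (λ C → (C [ x n i ]≔ false) [ y n i ]≔ true) phi-eq ⟩
      (((B [ y n i ]≔ false) [ x n i ]≔ true) [ x n i ]≔ false) [ y n i ]≔ true
                                                                 ≡⟨ move-back B (x≢y i i ∘ sym) y∈B x∉B ⟩
      B                                                          ∎
      where
      open ≡-Reasoning
      phi-eq : (A [ y n i ]≔ false) [ x n i ]≔ true ≡ (B [ y n i ]≔ false) [ x n i ]≔ true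
      phi-eq = trans (sym (phi-on-y A y∈A)) (trans eq (phi-on-y B y∈B))

    ∈-phi⁻ : ∀ A {v} → v ≢ x n i → v ≢ y n i → v ∈ phi i A → v ∈ A
    ∈-phi⁻ A v≢x v≢y v∈ = lookup⇒[]= _ A (trans (sym (lookup-phi A v≢x v≢y)) ([]=⇒lookup v∈))

    phi-independent : ∀ {A} → Independent {n} A → Independent {n} (phi i A)
    phi-independent {A} indA k with k ≟ᶠ i
    ... | yes refl = (λ (_ , y∈) → y∉ y∈) , (λ (y∈ , _) → y∉ y∈)
      where
      y∉ : ¬ (y n i ∈ phi i A)
      y∉ y∈ with () ← trans (sym ([]=⇒lookup y∈)) (y∉phi A)
    ... | no k≢i =
        (λ (x∈ , y∈) → proj₁ (indA k) (∈-phi⁻ A xk≢xi (x≢y k i) x∈ , ∈-phi⁻ A yk≢xi yk≢yi y∈))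
      , (λ (y∈ , z∈) → proj₂ (indA k) (∈-phi⁻ A yk≢xi yk≢yi y∈ , ∈-phi⁻ A (z≢x k i) (z≢y k i) z∈))
      where
      xk≢xi : x n k ≢ x n i
      xk≢xi = k≢i ∘ x-injective
      yk≢xi : y n k ≢ x n i
      yk≢xi = x≢y i k ∘ sym
      yk≢yi : y n k ≢ y n i
      yk≢yi = k≢i ∘ y-injective

    ∣phi∣ : ∀ {A} → Independent {n} A → ∣ phi i A ∣ ≡ ∣ A ∣
    ∣phi∣ {A} indA with lookup A (y n i) in y∈A
    ... | true  = ∣move∣ A (x≢y i i ∘ sym) y∈A (x∉-independent indA y∈A)
    ... | false = refl

  IndependentFamily : Family n → Set
  IndependentFamily F = ∀ A → T (F A) → Independent {n} A

  FamIndep⇒IndependentFamily : ∀ {r F} → FamIndep {n} r F → IndependentFamily F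
  FamIndep⇒IndependentFamily famF A A∈ = proj₁ (famF A A∈)

  module _ (i : Fin n) (F : Family n) where

    ∈Phi⁻ : ∀ B → T (Phi i F B) → (∃ λ A → T (F A) × phi i A ≡ B) ⊎ (T (F B) × T (F (phi i B)))
    ∈Phi⁻ B B∈ with to T-∨ B∈
    ... | inj₂ stable = inj₂ (to T-∧ stable)
    ... | inj₁ image with A , A∈∧phiA≡B ← satisfied (any⁻ _ (allSubsets (n * 3)) image)
                     with A∈ , phiA≡B ← to (T-∧ {F A}) A∈∧phiA≡B
      = inj₁ (A , A∈ , toWitness phiA≡B)

    phi∈Phi : ∀ A → T (F A) → T (Phi i F (phi i A))
    phi∈Phi A A∈ =
      from T-∨ (inj₁ (any⁺ _ (lose (∈-allSubsets A) (from T-∧ (A∈ , fromWitness refl)))))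

    ∈Phi⁺ : ∀ B → T (F B) → T (F (phi i B)) → T (Phi i F B)
    ∈Phi⁺ B B∈ phiB∈ = from T-∨ (inj₂ (from T-∧ (B∈ , phiB∈)))

    Phi-FamIndep : ∀ {r} → FamIndep {n} r F → FamIndep {n} r (Phi i F)
    Phi-FamIndep famF B B∈ with ∈Phi⁻ B B∈
    ... | inj₂ (B∈F , _)         = famF B B∈F
    ... | inj₁ (A , A∈F , refl) with indA , ∣A∣≡r ← famF A A∈F
      = phi-independent i indA , trans (∣phi∣ i indA) ∣A∣≡r

  module _ (i : Fin n) (F : Family n) (indF : IndependentFamily F)
           (S : VSet n) (x∉S : lookup S (x n i) ≡ false) (y∉S : lookup S (y n i) ≡ false) where

    private
      Sx Sy Sxy : VSet n
      Sx  = S [ x n i ]≔ true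
      Sy  = S [ y n i ]≔ true
      Sxy = Sy [ x n i ]≔ true

      y∉Sx : lookup Sx (y n i) ≡ false
      y∉Sx = trans (lookup∘update′ (x≢y i i ∘ sym) S true) y∉S
      y∈Sy : lookup Sy (y n i) ≡ true
      y∈Sy = lookup∘update (y n i) S true
      x∉Sy : lookup Sy (x n i) ≡ false
      x∉Sy = trans (lookup∘update′ (x≢y i i) S true) x∉S

      phi-Sy : phi i Sy ≡ Sx
      phi-Sy = trans (phi-on-y i Sy y∈Sy)
                     (cong (_[ x n i ]≔ true) (trans ([]≔-idempotent S (y n i)) ([]≔-lookup′ S y∉S)))

      image-∌y : ∀ {A B} → phi i A ≡ B → lookup B (y n i) ≡ true → ⊥
      image-∌y {A} refl y∈ with () ← trans (sym y∈) (y∉phi i A)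

      F-∌xy : ∀ {A} → T (F A) → lookup A (x n i) ≡ true → lookup A (y n i) ≡ true → ⊥
      F-∌xy {A} A∈ x∈ y∈ with () ← trans (sym x∈) (x∉-independent i (indF A A∈) y∈)

      x∈Sxy : lookup Sxy (x n i) ≡ true
      x∈Sxy = lookup∘update (x n i) Sy true
      y∈Sxy : lookup Sxy (y n i) ≡ true
      y∈Sxy = trans (lookup∘update′ (x≢y i i ∘ sym) Sy true) y∈Sy

    Phi-at-S : Phi i F S ≡ F S
    Phi-at-S = T-ext to-F (λ S∈ → ∈Phi⁺ i F S S∈ (subst (T ∘ F) (sym (phi-off-y i S y∉S)) S∈))
      where
      to-F : T (Phi i F S) → T (F S)
      to-F S∈ with ∈Phi⁻ i F S S∈
      ... | inj₂ (S∈F , _)          = S∈F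
      ... | inj₁ (A , A∈ , phiA≡S) = subst (T ∘ F) A≡S A∈
        where
        A≡S : A ≡ S
        A≡S = trans (sym (x∉phi⇒phi≡ i A (trans (cong (λ B → lookup B (x n i)) phiA≡S) x∉S))) phiA≡S

    Phi-at-Sx : Phi i F Sx ≡ F Sx ∨ F Sy
    Phi-at-Sx = T-ext to-F from-F
      where
      to-F : T (Phi i F Sx) → T (F Sx ∨ F Sy)
      to-F Sx∈ with ∈Phi⁻ i F Sx Sx∈
      ... | inj₂ (Sx∈F , _)          = from T-∨ (inj₁ Sx∈F)
      ... | inj₁ (A , A∈ , phiA≡Sx) with lookup A (y n i) in y∈A
      ...   | false = from T-∨ (inj₁ (subst (T ∘ F) phiA≡Sx A∈))
      ...   | true  = from (T-∨ {F Sx}) (inj₂ (subst (T ∘ F) A≡Sy A∈))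
        where
        A≡Sy : A ≡ Sy
        A≡Sy = phi-injective i (x∉-independent i (indF A A∈) y∈A) y∈A x∉Sy y∈Sy
                             (trans (phi-on-y i A y∈A) (trans phiA≡Sx (sym phi-Sy)))
      from-F : T (F Sx ∨ F Sy) → T (Phi i F Sx)
      from-F Sx∈∨Sy∈ with to (T-∨ {F Sx}) Sx∈∨Sy∈
      ... | inj₁ Sx∈ = ∈Phi⁺ i F Sx Sx∈ (subst (T ∘ F) (sym (phi-off-y i Sx y∉Sx)) Sx∈)
      ... | inj₂ Sy∈ = subst (T ∘ Phi i F) phi-Sy (phi∈Phi i F Sy Sy∈)

    Phi-at-Sy : Phi i F Sy ≡ F Sx ∧ F Sy
    Phi-at-Sy = T-ext to-F from-F
      where
      to-F : T (Phi i F Sy) → T (F Sx ∧ F Sy)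
      to-F Sy∈ with ∈Phi⁻ i F Sy Sy∈
      ... | inj₁ (A , _ , phiA≡Sy)   = ⊥-elim (image-∌y {A} phiA≡Sy y∈Sy)
      ... | inj₂ (Sy∈F , phiSy∈F)    = from T-∧ (subst (T ∘ F) phi-Sy phiSy∈F , Sy∈F)
      from-F : T (F Sx ∧ F Sy) → T (Phi i F Sy)
      from-F Sx∈∧Sy∈ with Sx∈ , Sy∈ ← to (T-∧ {F Sx}) Sx∈∧Sy∈
        = ∈Phi⁺ i F Sy Sy∈ (subst (T ∘ F) (sym phi-Sy) Sx∈)

    Phi-at-Sxy : Phi i F Sxy ≡ false
    Phi-at-Sxy = T-ext to-F λ ()
      where
      to-F : T (Phi i F Sxy) → T false
      to-F Sxy∈ with ∈Phi⁻ i F Sxy Sxy∈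
      ... | inj₁ (A , _ , phiA≡Sxy) = image-∌y {A} phiA≡Sxy y∈Sxy
      ... | inj₂ (Sxy∈F , _)        = F-∌xy Sxy∈F x∈Sxy y∈Sxy

    F-at-Sxy : F Sxy ≡ false
    F-at-Sxy = T-ext (λ Sxy∈ → F-∌xy Sxy∈ x∈Sxy y∈Sxy) λ ()

    squareSum-Phi : squareSum (x n i) (y n i) (indicator ∘ Phi i F) S
                  ≡ squareSum (x n i) (y n i) (indicator ∘ F) S
    squareSum-Phi =
      cong₂ _+_ (cong₂ _+_ (cong indicator Phi-at-S) (cong indicator (trans Phi-at-Sxy (sym F-at-Sxy))))
                (trans (cong₂ _+_ (cong indicator Phi-at-Sx) (cong indicator Phi-at-Sy))
                       (indicator-∨-∧ (F Sx) (F Sy)))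

  card-Phi : ∀ i (F : Family n) → IndependentFamily F → card n (Phi i F) ≡ card n F
  card-Phi i F indF = begin
    card n (Phi i F)                  ≡⟨ card≡∑ₛ n (Phi i F) ⟩
    ∑ₛ (n * 3) (indicator ∘ Phi i F)  ≡⟨ ∑ₛ-cong-squares (n * 3) (x≢y i i) (squareSum-Phi i F indF) ⟩
    ∑ₛ (n * 3) (indicator ∘ F)        ≡⟨ card≡∑ₛ n F ⟨
    card n F                          ∎
    where open ≡-Reasoning

  AvoidsY : List (Fin n) → Vtx n → Set
  AvoidsY js v = ∀ {j} → j ∈ˡ js → v ≢ y n j

  MeetAvoiding : List (Fin n) → VSet n → VSet n → Set
  MeetAvoiding js A B = ∃ λ v → lookup A v ≡ true × lookup B v ≡ true × AvoidsY js v

  IntersectingAvoiding : List (Fin n) → Family n → Set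
  IntersectingAvoiding js F = ∀ A B → T (F A) → T (F B) → MeetAvoiding js A B

  MeetAvoiding-sym : ∀ {js A B} → MeetAvoiding js A B → MeetAvoiding js B A
  MeetAvoiding-sym (v , v∈A , v∈B , av) = v , v∈B , v∈A , av

  module _ (i : Fin n) (js : List (Fin n)) (F : Family n) (indF : IndependentFamily F)
           (intF : IntersectingAvoiding js F) where

    private
      avoids-∷ : ∀ {v} → AvoidsY js v → v ≢ y n i → AvoidsY (i ∷ js) v
      avoids-∷ av v≢y (here refl) = v≢y
      avoids-∷ av v≢y (there j∈) = av j∈

      x-avoids : AvoidsY (i ∷ js) (x n i)
      x-avoids {j} _ = x≢y i j

      -- The vertex w that A shares with φ_i(B) is neither y_i ∉ φ_i(B) nor x_i ∉ A
      -- (A ∋ y_i is independent), so φ_i did not touch it and w ∈ B.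
      meet-via-phi : ∀ A B → T (F A) → lookup A (y n i) ≡ true → T (F (phi i B)) →
                     MeetAvoiding (i ∷ js) A B
      meet-via-phi A B A∈ y∈A phiB∈ with w , w∈A , w∈phiB , av ← intF A (phi i B) A∈ phiB∈
        = w , w∈A , w∈B , avoids-∷ av w≢y
        where
        w≢y : w ≢ y n i
        w≢y refl with () ← trans (sym w∈phiB) (y∉phi i B)
        w≢x : w ≢ x n i
        w≢x refl with () ← trans (sym w∈A) (x∉-independent i (indF A A∈) y∈A)
        w∈B : lookup B w ≡ true
        w∈B = trans (sym (lookup-phi i B w≢x w≢y)) w∈phiB

    meet-image-image : ∀ A B → T (F A) → T (F B) → MeetAvoiding (i ∷ js) (phi i A) (phi i B)
    meet-image-image A B A∈ B∈ with intF A B A∈ B∈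
    ... | v , v∈A , v∈B , av with v ≟ᶠ y n i
    ...   | yes refl = x n i , x∈phi i A v∈A , x∈phi i B v∈B , x-avoids
    ...   | no v≢y   = v , phi-preserves-∈ i A v≢y v∈A , phi-preserves-∈ i B v≢y v∈B , avoids-∷ av v≢y

    meet-image-stable : ∀ A B → T (F A) → T (F B) → T (F (phi i B)) → MeetAvoiding (i ∷ js) (phi i A) B
    meet-image-stable A B A∈ B∈ phiB∈ with intF A B A∈ B∈
    ... | v , v∈A , v∈B , av with v ≟ᶠ y n i
    ...   | no v≢y   = v , phi-preserves-∈ i A v≢y v∈A , v∈B , avoids-∷ av v≢y
    ...   | yes refl with w , w∈A , w∈B , av′ ← meet-via-phi A B A∈ v∈A phiB∈
      = w , phi-preserves-∈ i A (av′ (here refl)) w∈A , w∈B , av′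

    meet-stable-stable : ∀ A B → T (F A) → T (F (phi i A)) → T (F B) → T (F (phi i B)) →
                         MeetAvoiding (i ∷ js) A B
    meet-stable-stable A B A∈ phiA∈ B∈ phiB∈ with intF A B A∈ B∈
    ... | v , v∈A , v∈B , av with v ≟ᶠ y n i
    ...   | no v≢y   = v , v∈A , v∈B , avoids-∷ av v≢y
    ...   | yes refl = MeetAvoiding-sym {i ∷ js} {B} {A} (meet-via-phi B A B∈ v∈B phiA∈)

    Phi-intersectingAvoiding : IntersectingAvoiding (i ∷ js) (Phi i F)
    Phi-intersectingAvoiding A B A∈ B∈ with ∈Phi⁻ i F A A∈ | ∈Phi⁻ i F B B∈
    ... | inj₁ (A′ , A′∈ , refl) | inj₁ (B′ , B′∈ , refl) = meet-image-image A′ B′ A′∈ B′∈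
    ... | inj₁ (A′ , A′∈ , refl) | inj₂ (B∈F , phiB∈)     = meet-image-stable A′ B A′∈ B∈F phiB∈
    ... | inj₂ (A∈F , phiA∈)     | inj₁ (B′ , B′∈ , refl) =
      MeetAvoiding-sym {i ∷ js} {phi i B′} {A} (meet-image-stable B′ A B′∈ A∈F phiA∈)
    ... | inj₂ (A∈F , phiA∈)     | inj₂ (B∈F , phiB∈)     = meet-stable-stable A B A∈F phiA∈ B∈F phiB∈

  module _ {r : ℕ} (F : Family n) (famF : FamIndep {n} r F) where

    foldr-Phi-FamIndep : ∀ is → FamIndep {n} r (foldr Phi F is)
    foldr-Phi-FamIndep []       = famF
    foldr-Phi-FamIndep (i ∷ is) = Phi-FamIndep i (foldr Phi F is) (foldr-Phi-FamIndep is)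

    foldr-Phi-card : ∀ is → card n (foldr Phi F is) ≡ card n F
    foldr-Phi-card []       = refl
    foldr-Phi-card (i ∷ is) =
      trans (card-Phi i _ (FamIndep⇒IndependentFamily (foldr-Phi-FamIndep is))) (foldr-Phi-card is)

    foldr-Phi-intersectingAvoiding : Intersecting {n} F → ∀ is → IntersectingAvoiding is (foldr Phi F is)
    foldr-Phi-intersectingAvoiding intF [] A B A∈ B∈ with v , v∈A∩B ← intF A B A∈ B∈
                                                    with v∈A , v∈B ← x∈p∩q⁻ A B v∈A∩B
      = v , []=⇒lookup v∈A , []=⇒lookup v∈B , λ ()
    foldr-Phi-intersectingAvoiding intF (i ∷ is) =
      Phi-intersectingAvoiding i is _ (FamIndep⇒IndependentFamily (foldr-Phi-FamIndep is))
                               (foldr-Phi-intersectingAvoiding intF is)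

  avoids-all-y⇒InL : ∀ v → AvoidsY (allFin n) v → InL n v
  avoids-all-y⇒InL v av with combine-surjective {n} {3} v
  ... | j , zero , jk≡v             = j , inj₁ (sym jk≡v)
  ... | j , suc zero , jk≡v         = ⊥-elim (av (∈-allFin j) (sym jk≡v))
  ... | j , suc (suc zero) , jk≡v   = j , inj₂ (sym jk≡v)

lemma2 : (n r : ℕ) → .{{_ : NonZero n}} → .{{_ : NonZero r}} →
    (F : Family n) → FamIndep {n} r F → Intersecting {n} F →
    card n (PhiAll n F) ≡ card n F ×
    ((A B : VSet n) → _∈F_ {n} A (PhiAll n F) → _∈F_ {n} B (PhiAll n F) →
      ∃ λ (v : Vtx n) → v ∈ A × v ∈ B × InL n v)
lemma2 n r F famF intF = foldr-Phi-card n F famF (allFin n) , meet-in-L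
  where
  meet-in-L : (A B : VSet n) → T (PhiAll n F A) → T (PhiAll n F B) →
              ∃ λ (v : Vtx n) → v ∈ A × v ∈ B × InL n v
  meet-in-L A B A∈ B∈
    with v , v∈A , v∈B , av ← foldr-Phi-intersectingAvoiding n F famF intF (allFin n) A B A∈ B∈
    = v , lookup⇒[]= v A v∈A , lookup⇒[]= v B v∈B , avoids-all-y⇒InL n v av
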